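{- For every integer $k\ge 3$ there is a generating sequence for $n=4k+1$ of length $k$.
   Context: Let $n=4k+1$. A generating sequence for $n$ of length $m$ is a sequence $(a_0,\dots,a_{m-1})$ of elements of $\mathbb Z/n\mathbb Z$ together with a set $I\subseteq\{0,\dots,m-1\}$ such that: (1) $\sum_{i=0}^{m-1}a_i$ is coprime to $n$; (2) for all $i\in I$ we have $i+1\notin I$; (3) $|\{\pm a_0,\dots,\pm a_{m-1},\pm c_0,\dots,\pm c_{m-1}\}|=4m$, where $c_i=a_i+a_{i+1}$ if $i\notin I$ and $c_i=a_{i-1}+a_i+a_{i+1}$ if $i\in I$, with indices taken modulo $m$. -}

module Defs where

open import Data.Nat using (ℕ; zero; suc; _+_; _*_; _∸_; NonZero)
open import Data.Nat.DivMod using (_mod_)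
open import Data.Nat.Coprimality using (Coprime)
open import Data.Fin using (Fin; toℕ)
open import Data.List using (List; []; _∷_; map; allFin; concatMap)
open import Data.Nat.ListAction using (sum)
open import Data.List.Relation.Unary.Unique.Propositional using (Unique)
open import Data.Bool using (Bool; true; false; T; not)
open import Data.Product using (_×_)

-- Z/nZ is represented by Fin n (residues 0..n-1), with arithmetic mod n.
module _ {n : ℕ} .{{_ : NonZero n}} where
  _⊕_ : Fin n → Fin n → Fin n
  x ⊕ y = (toℕ x + toℕ y) mod n

  ⊖_ : Fin n → Fin n
  ⊖ x = (n ∸ toℕ x) mod n

  sumZ : List (Fin n) → Fin n
  sumZ xs = sum (map toℕ xs) mod n

module _ {m : ℕ} .{{_ : NonZero m}} where
  nextI : Fin m → Fin m
  nextI i = (toℕ i + 1) mod m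

  prevI : Fin m → Fin m
  prevI i = (toℕ i + (m ∸ 1)) mod m

module _ {n m : ℕ} .{{_ : NonZero n}} .{{_ : NonZero m}}
         (a : Fin m → Fin n) (I : Fin m → Bool) where
  cSeq : Fin m → Fin n
  cSeq i with I i
  ... | true  = (a (prevI i) ⊕ a i) ⊕ a (nextI i)
  ... | false = a i ⊕ a (nextI i)

  elems : List (Fin n)
  elems = concatMap (λ i → a i ∷ (⊖ a i) ∷ cSeq i ∷ (⊖ cSeq i) ∷ []) (allFin m)

  IsGeneratingSequence : Set
  IsGeneratingSequence =
    Coprime (toℕ (sumZ (map a (allFin m)))) n
    × (∀ (i : Fin m) → T (I i) → T (not (I (nextI i))))
    -- (3) |{±a_i, ±c_i}| = 4m, i.e. these 4m listed elements are pairwise distinct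
    × Unique elems

{-# OPTIONS --safe #-}
module Submission where

-- Every nonzero residue modulo the odd number n = 4k + 1 is ±w for exactly one
-- w ∈ {1, …, 2k}.  Hence the 4k residues ±aᵢ, ±cᵢ are pairwise distinct as soon as
-- the 2k numbers w belonging to a₀, …, a_{k-1}, c₀, …, c_{k-1} are, and this is shown
-- by cutting {1, …, 2k} into consecutive intervals on each of which w determines
-- the index affinely.  For even k (and for k = 3) the zigzag sequence
-- a_{2j} = k + 1 + j, a_{2j+1} = 2k + 1 + j with I = {k - 1} works: the cᵢ have the
-- classes 1, …, k, the a_{2j} the next ⌈k/2⌉ classes and the a_{2j+1} the rest.  For
-- odd k = 5 + 2g four special terms are put in front of a zigzag block of length
-- 2g + 1.  In both cases 64 · ∑ aᵢ + 1 is a multiple of n, so ∑ aᵢ is coprime to n.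

open import Defs
open import Data.Bool using (Bool; true; false; T; not)
open import Data.Empty using (⊥-elim)
open import Data.Fin using (Fin; toℕ)
open import Data.Fin.Properties using (toℕ-fromℕ<; toℕ-injective; toℕ<n)
import Data.Fin.Properties as Fin
open import Data.List using (List; []; _∷_; [_]; _++_; map; allFin; concatMap; tabulate; applyUpTo)
open import Data.List.Properties using (applyUpTo-∷ʳ; map-∘; map-cong; map-tabulate)
open import Data.List.Membership.Propositional using (_∈_)
open import Data.List.Relation.Unary.Any using (here; there)
import Data.List.Relation.Unary.All as All
import Data.List.Relation.Unary.All.Properties as Allₚ
import Data.List.Relation.Unary.AllPairs as AllPairs
import Data.List.Relation.Unary.AllPairs.Properties as AllPairsₚ
open import Data.List.Relation.Unary.Unique.Propositional using (Unique)
open import Data.List.Relation.Unary.Unique.Propositional.Properties using (concat⁺)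
import Data.List.Relation.Unary.Unique.DecPropositional as UniqueDec
open import Data.List.Relation.Binary.Disjoint.Propositional using (Disjoint)
open import Data.Nat using (ℕ; zero; suc; _+_; _*_; _∸_; _≤_; _<_; s≤s; z≤n; NonZero; >-nonZero; _≟_)
open import Data.Nat.Properties
open import Data.Nat.DivMod
  using (_%_; _/_; _mod_; m<n⇒m%n≡m; n%n≡0; [m+n]%n≡m%n; %-distribˡ-+; m%n%n≡m%n; m≡m%n+[m/n]*n)
open import Data.Nat.Divisibility using (_∣_; ∣n⇒∣m*n; ∣m+n∣m⇒∣n; ∣m∣n⇒∣m+n; ∣1⇒≡1)
open import Data.Nat.Coprimality using (Coprime; coprime?)
open import Data.Nat.ListAction using (sum)
open import Data.Nat.ListAction.Properties using (sum-++)
open import Data.Nat.Tactic.RingSolver using (solve)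
open import Data.Product using (∃-syntax; _×_; _,_)
open import Data.Sum using (inj₁; inj₂)
open import Data.Unit using (tt)
open import Function using (_∘_; id; const)
open import Relation.Binary.PropositionalEquality hiding ([_])
open import Relation.Nullary.Decidable using (does; toWitness; isYes≗does; dec-true; dec-false)

m+o≡n⇒m≤n : ∀ {m n} o → m + o ≡ n → m ≤ n
m+o≡n⇒m≤n o refl = m≤m+n _ o

m+m≢1+n+n : ∀ m n → m + m ≢ suc (n + n)
m+m≢1+n+n zero    n ()
m+m≢1+n+n (suc m) zero    eq = 1+n≢0 (trans (sym (+-suc m m)) (suc-injective eq))
m+m≢1+n+n (suc m) (suc n) eq
  rewrite +-suc m m | +-suc n n = m+m≢1+n+n m n (suc-injective (suc-injective eq))

[m%d+n]%d≡[m+n]%d : ∀ m n d .{{_ : NonZero d}} → (m % d + n) % d ≡ (m + n) % d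
[m%d+n]%d≡[m+n]%d m n d = begin
  (m % d + n) % d          ≡⟨ %-distribˡ-+ (m % d) n d ⟩
  (m % d % d + n % d) % d  ≡⟨ cong (λ x → (x + n % d) % d) (m%n%n≡m%n m d) ⟩
  (m % d + n % d) % d      ≡⟨ %-distribˡ-+ m n d ⟨
  (m + n) % d              ∎
  where open ≡-Reasoning

*+1≡*⇒coprime-% : ∀ {S} N .{{_ : NonZero N}} c Y → c * S + 1 ≡ Y * N → Coprime (S % N) N
*+1≡*⇒coprime-% {S} N c Y eq {d} (d∣S%N , d∣N) =
  ∣1⇒≡1 (∣m+n∣m⇒∣n (subst (d ∣_) (sym eq) (∣n⇒∣m*n Y d∣N)) (∣n⇒∣m*n c d∣S))
  where
  d∣S : d ∣ S
  d∣S = subst (d ∣_) (sym (m≡m%n+[m/n]*n S N)) (∣m∣n⇒∣m+n d∣S%N (∣n⇒∣m*n (S / N) d∣N))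

data Parity : ℕ → Set where
  even : ∀ j → Parity (2 * j)
  odd  : ∀ j → Parity (suc (2 * j))

parity : ∀ n → Parity n
parity zero    = even 0
parity (suc n) with parity n
... | even j = odd j
... | odd j  = subst Parity (*-suc 2 j) (even (suc j))

data Half : ℕ → ℕ → Set where
  even : ∀ j r → Half (j + r) (2 * j)
  odd  : ∀ j r → Half (j + r) (suc (2 * j))

half : ∀ h n → n < 2 + 2 * h → Half h n
half h       zero          _              = even 0 h
half h       (suc zero)    _              = odd 0 h
half zero    (suc (suc n)) (s≤s (s≤s ()))
half (suc h) (suc (suc n)) (s≤s (s≤s n<)) with half h n (subst (suc n ≤_) (*-suc 2 h) n<)
... | even j r = subst (Half _) (cong suc (+-suc j (j + 0))) (even (suc j) r)
... | odd j r  = subst (Half _) (cong (2 +_) (+-suc j (j + 0))) (odd (suc j) r)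

∑ : ℕ → (ℕ → ℕ) → ℕ
∑ n f = sum (applyUpTo f n)

∑-suc : ∀ n f → ∑ (suc n) f ≡ ∑ n f + f n
∑-suc n f = begin
  sum (applyUpTo f (suc n))       ≡⟨ cong sum (applyUpTo-∷ʳ f n) ⟨
  sum (applyUpTo f n ++ [ f n ])  ≡⟨ sum-++ (applyUpTo f n) [ f n ] ⟩
  ∑ n f + (f n + 0)               ≡⟨ cong (∑ n f +_) (+-identityʳ (f n)) ⟩
  ∑ n f + f n                     ∎
  where open ≡-Reasoning

tabulate-∘toℕ : ∀ n (f : ℕ → ℕ) → tabulate {n = n} (f ∘ toℕ) ≡ applyUpTo f n
tabulate-∘toℕ zero    f = refl
tabulate-∘toℕ (suc n) f = cong (f 0 ∷_) (tabulate-∘toℕ n (f ∘ suc))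

-- Residues up to sign

infix 4 _≡±_mod_
data _≡±_mod_ (v w N : ℕ) : Set where
  plus  : v ≡ w     → v ≡± w mod N
  minus : v + w ≡ N → v ≡± w mod N

≡±-unique : ∀ {v w w' N} → v ≡± w mod N → v ≡± w' mod N → w + w' < N → w ≡ w'
≡±-unique (plus refl) (plus refl)  _   = refl
≡±-unique (plus refl) (minus eq)   w<N = ⊥-elim (<-irrefl eq w<N)
≡±-unique {w = w} {w'} (minus eq) (plus refl) w<N = ⊥-elim (<-irrefl (trans (+-comm w w') eq) w<N)
≡±-unique (minus eq)  (minus eq')  _   = +-cancelˡ-≡ _ _ _ (trans eq (sym eq'))

-- The -via forms take the computation v ≡ u first, so that what remains is a closed
-- polynomial identity in u for the ring solver.
plus-via : ∀ {v u w N} → v ≡ u → u ≡ w → v ≡± w mod N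
plus-via v≡u u≡w = plus (trans v≡u u≡w)

minus-via : ∀ {v u w N} → v ≡ u → u + w ≡ N → v ≡± w mod N
minus-via v≡u u+w≡N = minus (trans (cong (_+ _) v≡u) u+w≡N)

module _ {v u w N : ℕ} .{{_ : NonZero N}} (v≡u : v ≡ u) where

  %-plus-via : u ≡ w + N → w < N → v % N ≡± w mod N
  %-plus-via u≡w+N w<N =
    plus (trans (cong (_% N) (trans v≡u u≡w+N)) (trans ([m+n]%n≡m%n w N) (m<n⇒m%n≡m w<N)))

  %-minus-via : u + suc w ≡ N → v % N ≡± suc w mod N
  %-minus-via u+1+w≡N = minus-via (trans (cong (_% N) v≡u) (m<n⇒m%n≡m u<N)) u+1+w≡N
    where
    u<N : u < N
    u<N = m+o≡n⇒m≤n w (trans (sym (+-suc u w)) u+1+w≡N)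

module _ {N : ℕ} .{{_ : NonZero N}} where

  toℕ-mod : ∀ v → toℕ (v mod N) ≡ v % N
  toℕ-mod v = toℕ-fromℕ< _

  toℕ-⊖+toℕ : ∀ (x : Fin N) → toℕ x ≢ 0 → toℕ (⊖ x) + toℕ x ≡ N
  toℕ-⊖+toℕ x x≢0 = begin
    toℕ (⊖ x) + toℕ x        ≡⟨ cong (_+ toℕ x) (toℕ-mod (N ∸ toℕ x)) ⟩
    (N ∸ toℕ x) % N + toℕ x  ≡⟨ cong (_+ toℕ x) (m<n⇒m%n≡m (∸-monoʳ-< (n≢0⇒n>0 x≢0) x≤N)) ⟩
    N ∸ toℕ x + toℕ x        ≡⟨ m∸n+n≡m x≤N ⟩
    N                        ∎
    where
    open ≡-Reasoning
    x≤N = <⇒≤ (toℕ<n x)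

-- Labelling residues by zones

data Direction : Set where
  ↑ ↓ : Direction

record Zone (C : Set) : Set where
  constructor zone
  field
    direction : Direction
    width     : ℕ
    code      : ℕ → C

pattern ascending  l f = zone ↑ l f
pattern descending l f = zone ↓ l f

point : ∀ {C} → C → Zone C
point c = ascending 1 (const c)

size : ∀ {C} → List (Zone C) → ℕ
size = sum ∘ map Zone.width

-- Consecutive zones cover the offsets 0, 1, …, size zs - 1; a zone of width l gives
-- its offsets the codes f 0, …, f (l - 1), in reverse order if it is descending.
data _∋_↦_ {C : Set} : List (Zone C) → ℕ → C → Set where
  here↑ : ∀ {l f zs t}     → t < l         → (ascending l f ∷ zs) ∋ t ↦ f t
  here↓ : ∀ {l f zs t s}   → t + suc s ≡ l → (descending l f ∷ zs) ∋ s ↦ f t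
  there : ∀ {d l f zs v c} → zs ∋ v ↦ c    → (zone d l f ∷ zs) ∋ l + v ↦ c

module _ {C : Set} where

  ∋↦-< : ∀ {zs v} {c : C} → zs ∋ v ↦ c → v < size zs
  ∋↦-< (here↑ t<l)          = m≤n⇒m≤n+o _ t<l
  ∋↦-< (here↓ {t = t} refl) = m≤n⇒m≤n+o _ (m≤n+m _ t)
  ∋↦-< (there {l = l} v∈zs) = +-monoʳ-< l (∋↦-< v∈zs)

  private
    descending-overflow : ∀ {t l v} → t + suc (l + v) ≢ l
    descending-overflow {t} {l} {v} eq = <-irrefl (sym eq) (≤-trans (s≤s (m≤m+n l v)) (m≤n+m _ t))

  ∋↦-functional : ∀ {zs v v'} {c c' : C} → zs ∋ v ↦ c → zs ∋ v' ↦ c' → v ≡ v' → c ≡ c'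
  ∋↦-functional (here↑ _)   (here↑ _)   refl = refl
  ∋↦-functional {v = s} (here↓ {f = f} {t = t} eq) (here↓ {t = t'} eq') refl =
    cong f (+-cancelʳ-≡ (suc s) t t' (trans eq (sym eq')))
  ∋↦-functional (here↑ t<l) (there _)   refl = ⊥-elim (m+n≮m _ _ t<l)
  ∋↦-functional (here↓ eq)  (there _)   refl = ⊥-elim (descending-overflow eq)
  ∋↦-functional (there _)   (here↑ t<l) refl = ⊥-elim (m+n≮m _ _ t<l)
  ∋↦-functional (there _)   (here↓ eq)  refl = ⊥-elim (descending-overflow eq)
  ∋↦-functional (there v∈)  (there v'∈) eq   = ∋↦-functional v∈ v'∈ (+-cancelˡ-≡ _ _ _ eq)

-- The residue v is ±(1 + w) and the zones give the offset w the code c; the shift by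
-- one keeps the residue 0 unlabelled.
data Labelled {C : Set} (zs : List (Zone C)) (N v : ℕ) (c : C) : Set where
  labelled : ∀ {w} → zs ∋ w ↦ c → v ≡± suc w mod N → Labelled zs N v c

labelled-subst : ∀ {C zs N u v} {c : C} → u ≡ v → Labelled zs N u c → Labelled zs N v c
labelled-subst refl ℓ = ℓ

module _ {N : ℕ} .{{_ : NonZero N}} {C : Set} {zs : List (Zone C)}
         (N≡ : N ≡ suc (size zs + size zs)) where

  private
    fits : ∀ {w w'} {c c' : C} → zs ∋ w ↦ c → zs ∋ w' ↦ c' → suc w + suc w' < N
    fits p q = subst (_ <_) (sym N≡) (s≤s (+-mono-≤ (∋↦-< p) (∋↦-< q)))

  labelled-functional : ∀ {v} {c c' : C} → Labelled zs N v c → Labelled zs N v c' → c ≡ c'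
  labelled-functional (labelled m p) (labelled m' p') =
    ∋↦-functional m m' (suc-injective (≡±-unique p p' (fits m m')))

  labelled-≢0 : ∀ {v} {c : C} → Labelled zs N v c → v ≢ 0
  labelled-≢0 (labelled _ (plus refl)) ()
  labelled-≢0 (labelled m (minus eq))  refl = <-irrefl eq (≤-trans (m≤m+n _ _) (fits m m))

  labelled-⊖ : ∀ {x : Fin N} {c : C} → Labelled zs N (toℕ x) c → Labelled zs N (toℕ (⊖ x)) c
  labelled-⊖ {x} ℓ@(labelled m (plus eq)) =
    labelled m (minus (trans (cong (toℕ (⊖ x) +_) (sym eq)) (toℕ-⊖+toℕ x (labelled-≢0 ℓ))))
  labelled-⊖ {x} ℓ@(labelled {w} m (minus eq)) =
    labelled m (plus (+-cancelʳ-≡ (toℕ x) _ _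
      (trans (toℕ-⊖+toℕ x (labelled-≢0 ℓ)) (trans (sym eq) (+-comm (toℕ x) (suc w))))))

  labelled-≢⊖ : ∀ {x : Fin N} {c : C} → Labelled zs N (toℕ x) c → x ≢ ⊖ x
  labelled-≢⊖ {x} ℓ x≡⊖x = m+m≢1+n+n (toℕ x) (size zs)
    (trans (cong (_+ toℕ x) (cong toℕ x≡⊖x)) (trans (toℕ-⊖+toℕ x (labelled-≢0 ℓ)) N≡))

data Entry : Set where
  a[_] c[_] : ℕ → Entry

position : Entry → ℕ
position a[ n ] = n
position c[ n ] = n

module _ {m : ℕ} {zs : List (Zone Entry)} (zs-size : size zs ≡ 2 * m)
         (P Q : Fin m → Fin (suc (4 * m)))
         (P-labelled : ∀ i → Labelled zs (suc (4 * m)) (toℕ (P i)) a[ toℕ i ])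
         (Q-labelled : ∀ i → Labelled zs (suc (4 * m)) (toℕ (Q i)) c[ toℕ i ]) where

  private
    N : ℕ
    N = suc (4 * m)

    N≡ : N ≡ suc (size zs + size zs)
    N≡ = cong suc (trans (*-distribʳ-+ m 2 2) (cong₂ _+_ (sym zs-size) (sym zs-size)))

    block : Fin m → List (Fin N)
    block i = P i ∷ ⊖ P i ∷ Q i ∷ ⊖ Q i ∷ []

    ≢-by-label : ∀ {x y : Fin N} {c c'} →
                 Labelled zs N (toℕ x) c → Labelled zs N (toℕ y) c' → c ≢ c' → x ≢ y
    ≢-by-label ℓ ℓ' c≢c' refl = c≢c' (labelled-functional N≡ ℓ ℓ')

    block-unique : ∀ i → Unique (block i)
    block-unique i =
      (labelled-≢⊖ N≡ p ∷ a≢c p q ∷ a≢c p ⊖q ∷ []) ∷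
      (a≢c ⊖p q ∷ a≢c ⊖p ⊖q ∷ []) ∷
      (labelled-≢⊖ N≡ q ∷ []) ∷ [] ∷ []
      where
      open All using ([]; _∷_)
      open AllPairs using ([]; _∷_)
      p  = P-labelled i
      q  = Q-labelled i
      ⊖p = labelled-⊖ N≡ p
      ⊖q = labelled-⊖ N≡ q
      a≢c : ∀ {x y : Fin N} → Labelled zs N (toℕ x) a[ toℕ i ] → Labelled zs N (toℕ y) c[ toℕ i ] → x ≢ y
      a≢c ℓ ℓ' = ≢-by-label ℓ ℓ' λ ()

    block-labelled : ∀ {i x} → x ∈ block i → ∃[ c ] Labelled zs N (toℕ x) c × position c ≡ toℕ i
    block-labelled {i} (here refl)                         = _ , P-labelled i , refl
    block-labelled {i} (there (here refl))                 = _ , labelled-⊖ N≡ (P-labelled i) , refl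
    block-labelled {i} (there (there (here refl)))         = _ , Q-labelled i , refl
    block-labelled {i} (there (there (there (here refl)))) = _ , labelled-⊖ N≡ (Q-labelled i) , refl

    blocks-disjoint : ∀ {i j} → i ≢ j → Disjoint (block i) (block j)
    blocks-disjoint i≢j (x∈i , x∈j) with block-labelled x∈i | block-labelled x∈j
    ... | c , ℓ , c≡i | c' , ℓ' , c'≡j =
      i≢j (toℕ-injective (trans (sym c≡i) (trans (cong position (labelled-functional N≡ ℓ ℓ')) c'≡j)))

  unique-± : Unique (concatMap (λ i → P i ∷ ⊖ P i ∷ Q i ∷ ⊖ Q i ∷ []) (allFin m))
  unique-± = concat⁺ (Allₚ.map⁺ (Allₚ.tabulate⁺ block-unique))
                     (AllPairsₚ.map⁺ (AllPairsₚ.tabulate⁺ blocks-disjoint))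

module _ {m : ℕ} .{{_ : NonZero m}} (i : Fin m) {n : ℕ} (i≡n : toℕ i ≡ n) where

  private
    toℕ-nextI≡ : toℕ (nextI i) ≡ suc n % m
    toℕ-nextI≡ = trans (toℕ-mod (toℕ i + 1)) (cong (_% m) (trans (+-comm (toℕ i) 1) (cong suc i≡n)))

  toℕ-nextI : suc n < m → toℕ (nextI i) ≡ suc n
  toℕ-nextI 1+n<m = trans toℕ-nextI≡ (m<n⇒m%n≡m 1+n<m)

  toℕ-nextI-last : suc n ≡ m → toℕ (nextI i) ≡ 0
  toℕ-nextI-last 1+n≡m = trans toℕ-nextI≡ (trans (cong (_% m) 1+n≡m) (n%n≡0 m))

toℕ-prevI : ∀ {m} .{{_ : NonZero m}} (i : Fin m) {n} → toℕ i ≡ suc n → toℕ (prevI i) ≡ n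
toℕ-prevI {suc m} i {n} i≡1+n = begin
  toℕ (prevI i)        ≡⟨ toℕ-mod (toℕ i + m) ⟩
  (toℕ i + m) % suc m  ≡⟨ cong (λ x → (x + m) % suc m) i≡1+n ⟩
  (suc n + m) % suc m  ≡⟨ cong (_% suc m) (sym (+-suc n m)) ⟩
  (n + suc m) % suc m  ≡⟨ [m+n]%n≡m%n n (suc m) ⟩
  n % suc m            ≡⟨ m<n⇒m%n≡m (<-trans (n<1+n n) (subst (_< suc m) i≡1+n (toℕ<n i))) ⟩
  n                    ∎
  where open ≡-Reasoning

module _ {N m : ℕ} .{{_ : NonZero N}} .{{_ : NonZero m}}
         (a : Fin m → Fin N) (I : Fin m → Bool) (i : Fin m) where

  cSeq-∉ : I i ≡ false → cSeq a I i ≡ a i ⊕ a (nextI i)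
  cSeq-∉ i∉I rewrite i∉I = refl

  cSeq-∈ : I i ≡ true → cSeq a I i ≡ (a (prevI i) ⊕ a i) ⊕ a (nextI i)
  cSeq-∈ i∈I rewrite i∈I = refl

module Sequence {N m : ℕ} .{{_ : NonZero N}} .{{_ : NonZero m}} (A : ℕ → ℕ) (J : ℕ → Bool) where

  a : Fin m → Fin N
  a i = A (toℕ i) mod N

  I : Fin m → Bool
  I i = J (toℕ i)

  module _ (A-< : ∀ n → n < m → A n < N) where

    toℕ-a : ∀ i {n} → toℕ i ≡ n → toℕ (a i) ≡ A n
    toℕ-a i refl = trans (toℕ-mod _) (m<n⇒m%n≡m (A-< _ (toℕ<n i)))

    toℕ-cSeq-∉ : ∀ i {n n'} → toℕ i ≡ n → J n ≡ false → toℕ (nextI i) ≡ n' →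
                 toℕ (cSeq a I i) ≡ (A n + A n') % N
    toℕ-cSeq-∉ i i≡n n∉J next≡n' = begin
      toℕ (cSeq a I i)                     ≡⟨ cong toℕ (cSeq-∉ a I i (trans (cong J i≡n) n∉J)) ⟩
      toℕ (a i ⊕ a (nextI i))              ≡⟨ toℕ-mod _ ⟩
      (toℕ (a i) + toℕ (a (nextI i))) % N
        ≡⟨ cong₂ (λ x y → (x + y) % N) (toℕ-a i i≡n) (toℕ-a _ next≡n') ⟩
      (A _ + A _) % N                      ∎
      where open ≡-Reasoning

    toℕ-cSeq-∈ : ∀ i {n⁻ n n'} → toℕ i ≡ n → J n ≡ true → toℕ (prevI i) ≡ n⁻ → toℕ (nextI i) ≡ n' →
                 toℕ (cSeq a I i) ≡ (A n⁻ + A n + A n') % N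
    toℕ-cSeq-∈ i {n⁻} {n} {n'} i≡n n∈J prev≡n⁻ next≡n' = begin
      toℕ (cSeq a I i)                         ≡⟨ cong toℕ (cSeq-∈ a I i (trans (cong J i≡n) n∈J)) ⟩
      toℕ ((a (prevI i) ⊕ a i) ⊕ a (nextI i))  ≡⟨ toℕ-mod _ ⟩
      (toℕ (a (prevI i) ⊕ a i) + toℕ (a (nextI i))) % N
        ≡⟨ cong (λ x → (x + toℕ (a (nextI i))) % N) (toℕ-mod _) ⟩
      ((toℕ (a (prevI i)) + toℕ (a i)) % N + toℕ (a (nextI i))) % N
        ≡⟨ [m%d+n]%d≡[m+n]%d _ _ N ⟩
      (toℕ (a (prevI i)) + toℕ (a i) + toℕ (a (nextI i))) % N
        ≡⟨ cong (_% N) (cong₂ _+_ (cong₂ _+_ (toℕ-a _ prev≡n⁻) (toℕ-a i i≡n)) (toℕ-a _ next≡n')) ⟩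
      (A n⁻ + A n + A n') % N                  ∎
      where open ≡-Reasoning

    toℕ-sumZ-a : toℕ (sumZ (map a (allFin m))) ≡ ∑ m A % N
    toℕ-sumZ-a = trans (toℕ-mod _) (cong (_% N) (begin
      sum (map toℕ (map a (allFin m)))  ≡⟨ cong sum (map-∘ (allFin m)) ⟨
      sum (map (toℕ ∘ a) (allFin m))    ≡⟨ cong sum (map-cong (λ i → toℕ-a i refl) (allFin m)) ⟩
      sum (map (A ∘ toℕ) (allFin m))    ≡⟨ cong sum (map-tabulate {n = m} id (A ∘ toℕ)) ⟩
      sum (tabulate {n = m} (A ∘ toℕ))  ≡⟨ cong sum (tabulate-∘toℕ m A) ⟩
      ∑ m A                             ∎))
      where open ≡-Reasoning

    sumZ-coprime : ∀ c Y → c * ∑ m A + 1 ≡ Y * N → Coprime (toℕ (sumZ (map a (allFin m)))) N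
    sumZ-coprime c Y eq = subst (λ x → Coprime x N) (sym toℕ-sumZ-a) (*+1≡*⇒coprime-% N c Y eq)

zigzag : ℕ → ℕ → ℕ → ℕ
zigzag p q zero          = p
zigzag p q (suc zero)    = q
zigzag p q (suc (suc n)) = suc (zigzag p q n)

zigzag-2* : ∀ p q j → zigzag p q (2 * j) ≡ p + j
zigzag-2* p q zero    = sym (+-identityʳ p)
zigzag-2* p q (suc j) = begin
  zigzag p q (2 * suc j)    ≡⟨ cong (zigzag p q) (*-suc 2 j) ⟩
  suc (zigzag p q (2 * j))  ≡⟨ cong suc (zigzag-2* p q j) ⟩
  suc (p + j)               ≡⟨ +-suc p j ⟨
  p + suc j                 ∎
  where open ≡-Reasoning

zigzag-1+2* : ∀ p q j → zigzag p q (suc (2 * j)) ≡ q + j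
zigzag-1+2* p q zero    = sym (+-identityʳ q)
zigzag-1+2* p q (suc j) = begin
  zigzag p q (suc (2 * suc j))    ≡⟨ cong (zigzag p q ∘ suc) (*-suc 2 j) ⟩
  suc (zigzag p q (suc (2 * j)))  ≡⟨ cong suc (zigzag-1+2* p q j) ⟩
  suc (q + j)                     ≡⟨ +-suc q j ⟨
  q + suc j                       ∎
  where open ≡-Reasoning

zigzag-+-suc : ∀ p q n → zigzag p q n + zigzag p q (suc n) ≡ p + q + n
zigzag-+-suc p q zero          = sym (+-identityʳ (p + q))
zigzag-+-suc p q (suc zero)    = trans (+-comm q (suc p)) (+-comm 1 (p + q))
zigzag-+-suc p q (suc (suc n)) = begin
  suc (zigzag p q n) + suc (zigzag p q (suc n))  ≡⟨ cong suc (+-suc _ _) ⟩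
  suc (suc (zigzag p q n + zigzag p q (suc n)))  ≡⟨ cong (suc ∘ suc) (zigzag-+-suc p q n) ⟩
  suc (suc (p + q + n))                          ≡⟨ solve (p ∷ q ∷ n ∷ []) ⟩
  p + q + suc (suc n)                            ∎
  where open ≡-Reasoning

zigzag-≤ : ∀ p q → p ≤ q → ∀ n → zigzag p q n ≤ n + q
zigzag-≤ p q p≤q zero          = p≤q
zigzag-≤ p q p≤q (suc zero)    = n≤1+n _
zigzag-≤ p q p≤q (suc (suc n)) = s≤s (m≤n⇒m≤1+n (zigzag-≤ p q p≤q n))

∑-zigzag-1+2* : ∀ p q j → ∑ (suc (2 * j)) (zigzag p q) ≡ j * (p + q + j) + p
∑-zigzag-1+2* p q zero    = +-identityʳ p
∑-zigzag-1+2* p q (suc j) = begin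
  ∑ (suc (2 * suc j)) zz             ≡⟨ cong (λ n → ∑ (suc n) zz) (*-suc 2 j) ⟩
  ∑ (3 + 2 * j) zz                   ≡⟨ ∑-suc (2 + 2 * j) zz ⟩
  ∑ (2 + 2 * j) zz + zz (2 + 2 * j)  ≡⟨ cong (_+ zz (2 + 2 * j)) (∑-suc (suc (2 * j)) zz) ⟩
  ∑ (suc (2 * j)) zz + zz (suc (2 * j)) + suc (zz (2 * j))
    ≡⟨ cong₂ (λ x y → x + y + suc (zz (2 * j))) (∑-zigzag-1+2* p q j) (zigzag-1+2* p q j) ⟩
  j * (p + q + j) + p + (q + j) + suc (zz (2 * j))
    ≡⟨ cong (λ x → j * (p + q + j) + p + (q + j) + suc x) (zigzag-2* p q j) ⟩
  j * (p + q + j) + p + (q + j) + suc (p + j)  ≡⟨ solve (p ∷ q ∷ j ∷ []) ⟩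
  suc j * (p + q + suc j) + p                  ∎
  where
  open ≡-Reasoning
  zz = zigzag p q

∑-zigzag-2+2* : ∀ p q j → ∑ (2 + 2 * j) (zigzag p q) ≡ suc j * (p + q + j)
∑-zigzag-2+2* p q j = begin
  ∑ (2 + 2 * j) (zigzag p q)
    ≡⟨ ∑-suc (suc (2 * j)) (zigzag p q) ⟩
  ∑ (suc (2 * j)) (zigzag p q) + zigzag p q (suc (2 * j))
    ≡⟨ cong₂ _+_ (∑-zigzag-1+2* p q j) (zigzag-1+2* p q j) ⟩
  j * (p + q + j) + p + (q + j)
    ≡⟨ solve (p ∷ q ∷ j ∷ []) ⟩
  suc j * (p + q + j)
    ∎
  where open ≡-Reasoning

-- The construction for even k and for k = 3

zigzagA : ℕ → ℕ → ℕ
zigzagA k = zigzag (suc k) (suc (2 * k))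

isLast : ℕ → ℕ → Bool
isLast k n = does (suc n ≟ k)

module Zigzag (k : ℕ) .{{_ : NonZero k}} = Sequence {suc (4 * k)} {k} (zigzagA k) (isLast k)

zigzagA-+-suc : ∀ k n → zigzagA k n + zigzagA k (suc n) ≡ suc k + suc (2 * k) + n
zigzagA-+-suc k = zigzag-+-suc (suc k) (suc (2 * k))

zigzagA-< : ∀ k n → n < k → zigzagA k n < suc (4 * k)
zigzagA-< k n n<k with m≤n⇒∃[o]m+o≡n n<k
... | r , refl = s≤s (begin
  zigzagA (suc n + r) n          ≤⟨ zigzag-≤ _ _ (s≤s (m≤m+n (suc n + r) _)) n ⟩
  n + suc (2 * (suc n + r))      ≤⟨ m+o≡n⇒m≤n (suc (n + 2 * r)) (solve (n ∷ r ∷ [])) ⟩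
  4 * (suc n + r)                ∎)
  where open ≤-Reasoning

zigzagZones : ℕ → List (Zone Entry)
zigzagZones h =
  descending (suc (2 * h)) c[_] ∷
  point c[ suc (2 * h) ] ∷
  ascending (suc h) (λ j → a[ 2 * j ]) ∷
  descending (suc h) (λ j → a[ suc (2 * j) ]) ∷ []

zigzag-a-labelled : ∀ h n → n < 2 + 2 * h →
  Labelled (zigzagZones h) (suc (4 * (2 + 2 * h))) (zigzagA (2 + 2 * h) n) a[ n ]
zigzag-a-labelled h n n< with half h n n<
... | even j r = labelled (there (there (here↑ (s≤s (m≤m+n j r)))))
  (plus-via (zigzag-2* _ _ j) (solve (j ∷ r ∷ [])))
... | odd j r  = labelled (there (there (there (here↓ (+-suc j r)))))
  (minus-via (zigzag-1+2* _ _ j) (solve (j ∷ r ∷ [])))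

zigzag-c-labelled : ∀ {zs} l n r → n + r ≡ l →
  Labelled (descending (suc l) c[_] ∷ zs) (suc (4 * (2 + l)))
           ((zigzagA (2 + l) n + zigzagA (2 + l) (suc n)) % suc (4 * (2 + l))) c[ n ]
zigzag-c-labelled .(n + r) n r refl =
  labelled (here↓ (+-suc n r)) (%-minus-via (zigzagA-+-suc (2 + n + r) n) (solve (n ∷ r ∷ [])))

zigzag-last-labelled : ∀ {zs} l {n} → n ≡ suc l →
  Labelled (descending (suc l) c[_] ∷ point c[ suc l ] ∷ zs) (suc (4 * (2 + l)))
           ((zigzagA (2 + l) l + zigzagA (2 + l) (suc l) + zigzagA (2 + l) 0) % suc (4 * (2 + l))) c[ n ]
zigzag-last-labelled l refl =
  labelled (there (here↑ (s≤s z≤n)))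
    (%-plus-via (cong (_+ suc (2 + l)) (zigzagA-+-suc (2 + l) l)) (solve (l ∷ []))
                (m+o≡n⇒m≤n (6 + 3 * l) (solve (l ∷ []))))

module _ (l : ℕ) where
  open Zigzag (2 + l)

  zigzag-isolated : ∀ i → T (I i) → T (not (I (nextI i)))
  zigzag-isolated i i∈I = subst (T ∘ not ∘ isLast (2 + l)) (sym (toℕ-nextI-last i refl last)) tt
    where
    last : suc (toℕ i) ≡ 2 + l
    last = toWitness (subst T (sym (isYes≗does (suc (toℕ i) ≟ 2 + l))) i∈I)

  zigzag-cSeq-labelled : ∀ {zs} i →
    Labelled (descending (suc l) c[_] ∷ point c[ suc l ] ∷ zs) (suc (4 * (2 + l)))
             (toℕ (cSeq a I i)) c[ toℕ i ]
  zigzag-cSeq-labelled i with m≤n⇒m<n∨m≡n (toℕ<n i)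
  ... | inj₁ 1+i<k with m≤n⇒∃[o]m+o≡n (≤-pred (≤-pred 1+i<k))
  ...   | r , i+r≡l =
    labelled-subst
      (sym (toℕ-cSeq-∉ (zigzagA-< (2 + l)) i refl (dec-false (suc (toℕ i) ≟ 2 + l) (<⇒≢ 1+i<k))
                       (toℕ-nextI i refl 1+i<k)))
      (zigzag-c-labelled l (toℕ i) r i+r≡l)
  zigzag-cSeq-labelled i | inj₂ 1+i≡k =
    labelled-subst
      (sym (toℕ-cSeq-∈ (zigzagA-< (2 + l)) i i≡1+l (dec-true (2 + l ≟ 2 + l) refl)
                       (toℕ-prevI i i≡1+l) (toℕ-nextI-last i refl 1+i≡k)))
      (zigzag-last-labelled l i≡1+l)
    where
    i≡1+l : toℕ i ≡ suc l
    i≡1+l = suc-injective 1+i≡k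

module _ (h : ℕ) where
  open Zigzag (2 + 2 * h)

  zigzagZones-size : size (zigzagZones h) ≡ 2 * (2 + 2 * h)
  zigzagZones-size = begin
    size (zigzagZones h)                       ≡⟨⟩
    suc (2 * h) + (1 + (suc h + (suc h + 0)))  ≡⟨ solve (h ∷ []) ⟩
    2 * (2 + 2 * h)                            ∎
    where open ≡-Reasoning

  zigzag-generating : IsGeneratingSequence a I
  zigzag-generating =
    sumZ-coprime (zigzagA-< _) 64 (56 * suc h + 1)
      (trans (cong (λ S → 64 * S + 1) (∑-zigzag-2+2* (suc (2 + 2 * h)) (suc (2 * (2 + 2 * h))) h))
             (solve (h ∷ []))) ,
    zigzag-isolated (2 * h) ,
    unique-± zigzagZones-size a (cSeq a I)
      (λ i → labelled-subst (sym (toℕ-a (zigzagA-< _) i refl)) (zigzag-a-labelled h (toℕ i) (toℕ<n i)))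
      (zigzag-cSeq-labelled (2 * h))

zigzag-generating-3 : IsGeneratingSequence (Zigzag.a 3) (Zigzag.I 3)
zigzag-generating-3 =
  toWitness {a? = coprime? (toℕ (sumZ (map a (allFin 3)))) 13} tt ,
  zigzag-isolated 1 ,
  toWitness {a? = UniqueDec.unique? Fin._≟_ (elems a I)} tt
  where open Zigzag 3

-- The construction for odd k ≥ 5

-- With k = 5 + 2g: k - 1, 3k + 3, k + 1, k, followed by the zigzag k + 3, 2k + 2, k + 4, …
-- of length 2g + 1.
oddA : ℕ → ℕ → ℕ
oddA g 0 = 4 + 2 * g
oddA g 1 = 18 + 6 * g
oddA g 2 = 6 + 2 * g
oddA g 3 = 5 + 2 * g
oddA g (suc (suc (suc (suc n)))) = zigzag (8 + 2 * g) (12 + 4 * g) n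

oddJ : ℕ → Bool
oddJ 1 = true
oddJ 3 = true
oddJ _ = false

module Odd (g : ℕ) = Sequence {suc (4 * (5 + 2 * g))} {5 + 2 * g} (oddA g) oddJ

oddA-< : ∀ g n → n < 5 + 2 * g → oddA g n < suc (4 * (5 + 2 * g))
oddA-< g 0 _ = m+o≡n⇒m≤n {5 + 2 * g} (16 + 6 * g) (solve (g ∷ []))
oddA-< g 1 _ = m+o≡n⇒m≤n {19 + 6 * g} (2 + 2 * g) (solve (g ∷ []))
oddA-< g 2 _ = m+o≡n⇒m≤n {7 + 2 * g} (14 + 6 * g) (solve (g ∷ []))
oddA-< g 3 _ = m+o≡n⇒m≤n {6 + 2 * g} (15 + 6 * g) (solve (g ∷ []))
oddA-< g (suc (suc (suc (suc n)))) (s≤s (s≤s (s≤s (s≤s (s≤s n≤2g))))) = begin-strict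
  zigzag (8 + 2 * g) (12 + 4 * g) n
    ≤⟨ zigzag-≤ (8 + 2 * g) (12 + 4 * g) (m+o≡n⇒m≤n (4 + 2 * g) (solve (g ∷ []))) n ⟩
  n + (12 + 4 * g)       ≤⟨ +-monoˡ-≤ (12 + 4 * g) n≤2g ⟩
  2 * g + (12 + 4 * g)   <⟨ m+o≡n⇒m≤n (8 + 2 * g) (solve (g ∷ [])) ⟩
  suc (4 * (5 + 2 * g))  ∎
  where open ≤-Reasoning

oddZones : ℕ → List (Zone Entry)
oddZones g =
  point c[ 0 ] ∷
  descending (2 * g) (λ n → c[ 4 + n ]) ∷
  point c[ 3 ] ∷ point a[ 1 ] ∷ point a[ 0 ] ∷ point a[ 3 ] ∷ point a[ 2 ] ∷ point c[ 1 ] ∷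
  ascending (suc g) (λ j → a[ 4 + 2 * j ]) ∷
  point c[ 4 + 2 * g ] ∷
  descending g (λ j → a[ 5 + 2 * j ]) ∷
  point c[ 2 ] ∷ []

odd-a-labelled : ∀ g n → n < 5 + 2 * g → Labelled (oddZones g) (suc (4 * (5 + 2 * g))) (oddA g n) a[ n ]
odd-a-labelled g 0 _ = labelled (there (there (there (there (here↑ (s≤s z≤n))))))
  (plus-via {u = 4 + 2 * g} refl (solve (g ∷ [])))
odd-a-labelled g 1 _ = labelled (there (there (there (here↑ (s≤s z≤n)))))
  (minus-via {u = 18 + 6 * g} refl (solve (g ∷ [])))
odd-a-labelled g 2 _ = labelled (there (there (there (there (there (there (here↑ (s≤s z≤n))))))))
  (plus-via {u = 6 + 2 * g} refl (solve (g ∷ [])))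
odd-a-labelled g 3 _ = labelled (there (there (there (there (there (here↑ (s≤s z≤n)))))))
  (plus-via {u = 5 + 2 * g} refl (solve (g ∷ [])))
odd-a-labelled g (suc (suc (suc (suc n)))) (s≤s (s≤s (s≤s (s≤s (s≤s n≤2g)))))
  with half g n (≤-trans (s≤s n≤2g) (n≤1+n _))
... | even j r =
  labelled (there (there (there (there (there (there (there (there (here↑ (s≤s (m≤m+n j r)))))))))))
    (plus-via (zigzag-2* _ _ j) (solve (j ∷ r ∷ [])))
... | odd j zero = ⊥-elim (1+n≰n (subst (λ x → suc (2 * j) ≤ 2 * x) (+-identityʳ j) n≤2g))
... | odd j (suc r) =
  labelled (there (there (there (there (there (there (there (there (there (there (here↓ refl)))))))))))
    (minus-via (zigzag-1+2* _ _ j) (solve (j ∷ r ∷ [])))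

odd-bulk-c-labelled : ∀ g m s → m + suc s ≡ 2 * g →
  Labelled (oddZones g) (suc (4 * (5 + 2 * g)))
           ((oddA g (4 + m) + oddA g (5 + m)) % suc (4 * (5 + 2 * g))) c[ 4 + m ]
odd-bulk-c-labelled g m s m+1+s≡2g =
  labelled (there (here↓ m+1+s≡2g)) (%-minus-via (zigzag-+-suc _ _ m) (begin
    8 + 2 * g + (12 + 4 * g) + m + suc (1 + s)  ≡⟨ solve (g ∷ m ∷ s ∷ []) ⟩
    21 + 6 * g + (m + suc s)                    ≡⟨ cong (21 + 6 * g +_) m+1+s≡2g ⟩
    21 + 6 * g + 2 * g                          ≡⟨ solve (g ∷ []) ⟩
    suc (4 * (5 + 2 * g))                       ∎))
  where open ≡-Reasoning

odd-last-c-labelled : ∀ g →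
  Labelled (oddZones g) (suc (4 * (5 + 2 * g)))
           ((oddA g (4 + 2 * g) + oddA g 0) % suc (4 * (5 + 2 * g))) c[ 4 + 2 * g ]
odd-last-c-labelled g =
  labelled (there (there (there (there (there (there (there (there (there (here↑ (s≤s z≤n)))))))))))
    (%-minus-via (cong (_+ (4 + 2 * g)) (zigzag-2* _ _ g)) (solve (g ∷ [])))

module _ (g : ℕ) where
  open Odd g

  private
    A-< = oddA-< g

  odd-cSeq-labelled : ∀ i {n} → toℕ i ≡ n →
    Labelled (oddZones g) (suc (4 * (5 + 2 * g))) (toℕ (cSeq a I i)) c[ n ]
  odd-cSeq-labelled i {0} i≡n =
    labelled-subst (sym (toℕ-cSeq-∉ A-< i i≡n refl (toℕ-nextI i i≡n (s≤s (s≤s z≤n)))))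
      (labelled (here↑ (s≤s z≤n))
        (%-plus-via {u = 4 + 2 * g + (18 + 6 * g)} refl (solve (g ∷ [])) (s≤s (s≤s z≤n))))
  odd-cSeq-labelled i {1} i≡n =
    labelled-subst
      (sym (toℕ-cSeq-∈ A-< i i≡n refl (toℕ-prevI i i≡n) (toℕ-nextI i i≡n (s≤s (s≤s (s≤s z≤n))))))
      (labelled (there (there (there (there (there (there (there (here↑ (s≤s z≤n)))))))))
        (%-plus-via {u = 4 + 2 * g + (18 + 6 * g) + (6 + 2 * g)} refl (solve (g ∷ []))
                    (m+o≡n⇒m≤n (13 + 6 * g) (solve (g ∷ [])))))
  odd-cSeq-labelled i {2} i≡n =
    labelled-subst (sym (toℕ-cSeq-∉ A-< i i≡n refl (toℕ-nextI i i≡n (s≤s (s≤s (s≤s (s≤s z≤n)))))))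
      (labelled (there (there (there (there (there (there (there (there (there (there (there
                  (here↑ (s≤s z≤n)))))))))))))
        (%-minus-via {u = 6 + 2 * g + (5 + 2 * g)} refl (solve (g ∷ []))))
  odd-cSeq-labelled i {3} i≡n =
    labelled-subst
      (sym (toℕ-cSeq-∈ A-< i i≡n refl (toℕ-prevI i i≡n)
                       (toℕ-nextI i i≡n (s≤s (s≤s (s≤s (s≤s (s≤s z≤n))))))))
      (labelled (there (there (here↑ (s≤s z≤n))))
        (%-minus-via {u = 6 + 2 * g + (5 + 2 * g) + (8 + 2 * g)} refl (solve (g ∷ []))))
  odd-cSeq-labelled i {suc (suc (suc (suc m)))} i≡n
    with m≤n⇒m<n∨m≡n (≤-pred (≤-pred (≤-pred (≤-pred (≤-pred (subst (_< 5 + 2 * g) i≡n (toℕ<n i)))))))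
  ... | inj₁ m<2g with m≤n⇒∃[o]m+o≡n m<2g
  ...   | s , 1+m+s≡2g =
    labelled-subst (sym (toℕ-cSeq-∉ A-< i i≡n refl (toℕ-nextI i i≡n (s≤s (s≤s (s≤s (s≤s (s≤s m<2g))))))))
      (odd-bulk-c-labelled g m s (trans (+-suc m s) 1+m+s≡2g))
  odd-cSeq-labelled i {suc (suc (suc (suc m)))} i≡n | inj₂ refl =
    labelled-subst (sym (toℕ-cSeq-∉ A-< i i≡n refl (toℕ-nextI-last i i≡n refl))) (odd-last-c-labelled g)

  odd-isolated : ∀ i → T (I i) → T (not (I (nextI i)))
  odd-isolated i = isolated refl
    where
    isolated : ∀ {n} → toℕ i ≡ n → T (oddJ n) → T (not (I (nextI i)))
    isolated {1} i≡1 _ = subst (T ∘ not ∘ oddJ) (sym (toℕ-nextI i i≡1 (s≤s (s≤s (s≤s z≤n))))) tt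
    isolated {3} i≡3 _ =
      subst (T ∘ not ∘ oddJ) (sym (toℕ-nextI i i≡3 (s≤s (s≤s (s≤s (s≤s (s≤s z≤n))))))) tt

  oddZones-size : size (oddZones g) ≡ 2 * (5 + 2 * g)
  oddZones-size = begin
    size (oddZones g)                                  ≡⟨⟩
    1 + (2 * g + (6 + (suc g + (1 + (g + (1 + 0))))))  ≡⟨ solve (g ∷ []) ⟩
    2 * (5 + 2 * g)                                    ∎
    where open ≡-Reasoning

  odd-generating : IsGeneratingSequence a I
  odd-generating =
    sumZ-coprime A-< 64 (56 * g + 125)
      (trans (cong (λ S → 64 * (4 + 2 * g + (18 + 6 * g + (6 + 2 * g + (5 + 2 * g + S)))) + 1)
                   (∑-zigzag-1+2* (8 + 2 * g) (12 + 4 * g) g))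
             (solve (g ∷ []))) ,
    odd-isolated ,
    unique-± oddZones-size a (cSeq a I)
      (λ i → labelled-subst (sym (toℕ-a A-< i refl)) (odd-a-labelled g (toℕ i) (toℕ<n i)))
      (λ i → odd-cSeq-labelled i refl)

data Shape : ℕ → Set where
  even  : ∀ h → Shape (2 + 2 * h)
  three : Shape 3
  odd   : ∀ g → Shape (5 + 2 * g)

shape : ∀ k → 3 ≤ k → Shape k
shape k 3≤k with parity k
shape .(2 * 0)               ()             | even 0
shape .(2 * 1)               (s≤s (s≤s ())) | even 1
shape .(2 * suc (suc h))     _              | even (suc (suc h)) =
  subst Shape (sym (*-suc 2 (suc h))) (even (suc h))
shape .(suc (2 * 0))         (s≤s ())       | odd 0
shape .(suc (2 * 1))         _              | odd 1 = three
shape .(suc (2 * suc (suc g))) _            | odd (suc (suc g)) =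
  subst Shape (sym (cong suc (trans (*-suc 2 (suc g)) (cong (2 +_) (*-suc 2 g))))) (odd g)

lemma2p5 : ∀ (k : ℕ) → (h : 3 ≤ k) →
    ∃[ a ] ∃[ I ] IsGeneratingSequence {suc (4 * k)} {k}
      {{_}} {{>-nonZero (≤-trans (s≤s z≤n) h)}} a I
lemma2p5 k 3≤k with shape k 3≤k
... | even h = Zigzag.a (2 + 2 * h) , Zigzag.I (2 + 2 * h) , zigzag-generating h
... | three  = Zigzag.a 3 , Zigzag.I 3 , zigzag-generating-3
... | odd g  = Odd.a g , Odd.I g , odd-generating g
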